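{- Let $c$ be a Coxeter element of $\widehat{\mathfrak S}_n$ and $\prec$ a TITO on $\mathbb Z$ satisfying the shape condition (1) of the context. The following are equivalent: (i) $\prec$ is $c$-sortable; (ii) $\prec$ avoids the patterns $k\prec i\prec j$ with $i<j<k$, $j\in\overline{L_c}$ and only finitely many elements $\prec$-between $k$ and $i$, and the patterns $j\prec k\prec i$ with $i<j<k$, $j\in\overline{R_c}$ and only finitely many elements $\prec$-between $k$ and $i$; (iii) $\prec$ avoids the patterns $k\prec i\prec j$ with $i<j<k$, $k$ and $i$ consecutive in $\prec$, and $j\in\overline{L_c}$, and the patterns $j\prec k\prec i$ with $i<j<k$, $k$ and $i$ consecutive in $\prec$, and $j\in\overline{R_c}$.
   Context: A Coxeter element $c$ of $\widehat{\mathfrak S}_n$ (product, once each, of the simple generators $s_i$, $0\le i\le n-1$, exchanging $i+mn$ and $i+1+mn$ for all $m$) moves every integer; $\overline{L_c}=\{x:c(x)>x\}$, $\overline{R_c}=\{x:c(x)<x\}$. A (real) TITO on $\mathbb Z$ is a total order $\prec$ with $x\prec y\iff x+n\prec y+n$ and no cover relation $x+n\prec x$. Blocks are the classes of the equivalence "finitely many elements $\prec$-between"; they are $\prec$-intervals, unions of residue classes mod $n$, linearly ordered; a block is waning if $x+n\prec x$ for its elements, waxing otherwise. Shape condition (1): either $\prec$ is a single waxing block, or its blocks are, in order, possibly a waxing block contained in $\overline{L_c}$, a waning block meeting both $\overline{L_c}$ and $\overline{R_c}$, possibly a waxing block contained in $\overline{R_c}$, and no other blocks. Pattern condition (2): no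 $i<j<k$ with $k\prec i\prec j$ and $j\in\overline{L_c}$, nor with $j\prec k\prec i$ and $j\in\overline{R_c}$. $\prec$ is $c$-sortable if it satisfies (1) and (2). -}

module Defs where

open import Data.Nat as ℕ using (ℕ; NonZero; _≡ᵇ_)
open import Data.Integer as ℤ using (ℤ; +_; _+_; _-_; _<_; _%ℕ_)
open import Data.Fin using (Fin; toℕ)
open import Data.Bool using (if_then_else_)
open import Data.List using (List; foldr; allFin)
open import Data.List.Membership.Propositional using (_∈_)
open import Data.List.Relation.Binary.Permutation.Propositional using (_↭_)
open import Data.Product using (Σ; ∃; _×_)
open import Data.Sum using (_⊎_)
open import Function using (_∘_; id)
open import Relation.Nullary using (¬_)
open import Relation.Binary.PropositionalEquality using (_≡_)
open import Relation.Binary.Structures using (IsStrictTotalOrder)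
open import Level using (0ℓ)

module _ (n : ℕ) .{{_ : NonZero n}} where

  gen : Fin n → ℤ → ℤ
  gen i x =
    if (x %ℕ n) ≡ᵇ toℕ i then x + ℤ.1ℤ
    else if (x %ℕ n) ≡ᵇ ((toℕ i ℕ.+ 1) ℕ.% n) then x - ℤ.1ℤ
    else x

  record CoxeterWord : Set where
    field
      word   : List (Fin n)
      isPerm : word ↭ allFin n

  coxeterElt : CoxeterWord → ℤ → ℤ
  coxeterElt w = foldr (λ i f → gen i ∘ f) id (CoxeterWord.word w)

  Lc : CoxeterWord → ℤ → Set
  Lc w x = x < coxeterElt w x

  Rc : CoxeterWord → ℤ → Set
  Rc w x = coxeterElt w x < x

module _ (_≺_ : ℤ → ℤ → Set) where

  Between : ℤ → ℤ → ℤ → Set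
  Between x y z = (x ≺ z × z ≺ y) ⊎ (y ≺ z × z ≺ x)

  -- x and y are in the same block: only finitely many elements
  -- ≺-between them (all of them occur in some finite list)
  SameBlock : ℤ → ℤ → Set
  SameBlock x y = Σ (List ℤ) λ L → ∀ z → Between x y z → z ∈ L

  Consecutive : ℤ → ℤ → Set
  Consecutive x y = x ≺ y × (∀ z → ¬ (x ≺ z × z ≺ y))

module _ (n : ℕ) (_≺_ : ℤ → ℤ → Set) where

  record IsTITO : Set where
    field
      strictTotal : IsStrictTotalOrder _≡_ _≺_
      translate   : ∀ x y → (x ≺ y → (x + + n) ≺ (y + + n))
                          × ((x + + n) ≺ (y + + n) → x ≺ y)
      noCover     : ∀ x → ¬ Consecutive _≺_ (x + + n) x

module _ (n : ℕ) .{{_ : NonZero n}} (c : CoxeterWord n) (_≺_ : ℤ → ℤ → Set) where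

  private
    L = Lc n c
    R = Rc n c
    Blk = SameBlock _≺_

  Shape : Set
  Shape =
    -- a single waxing block
    ((∀ x y → Blk x y) × (∀ x → x ≺ (x + + n)))
    ⊎
    -- a waning block (the block of w) meeting both L̄_c and R̄_c, possibly
    -- preceded by one waxing block contained in L̄_c and possibly followed by
    -- one waxing block contained in R̄_c, and no other blocks
    (∃ λ w →
        (∀ x → Blk w x → (x + + n) ≺ x)
      × (∃ λ x → Blk w x × L x)
      × (∃ λ x → Blk w x × R x)
      × (∀ x y → ¬ Blk w x → ¬ Blk w y → x ≺ w → y ≺ w → Blk x y)
      × (∀ x y → ¬ Blk w x → ¬ Blk w y → w ≺ x → w ≺ y → Blk x y)
      × (∀ x → ¬ Blk w x → x ≺ w → x ≺ (x + + n) × L x)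
      × (∀ x → ¬ Blk w x → w ≺ x → x ≺ (x + + n) × R x))

  Pattern : Set
  Pattern =
      (∀ i j k → i < j → j < k → ¬ (k ≺ i × i ≺ j × L j))
    × (∀ i j k → i < j → j < k → ¬ (j ≺ k × k ≺ i × R j))

  Sortable : Set
  Sortable = Shape × Pattern

  PatternBlock : Set
  PatternBlock =
      (∀ i j k → i < j → j < k → ¬ (k ≺ i × i ≺ j × L j × Blk k i))
    × (∀ i j k → i < j → j < k → ¬ (j ≺ k × k ≺ i × R j × Blk k i))

  PatternConsec : Set
  PatternConsec =
      (∀ i j k → i < j → j < k → ¬ (Consecutive _≺_ k i × i ≺ j × L j))
    × (∀ i j k → i < j → j < k → ¬ (j ≺ k × Consecutive _≺_ k i × R j))

-- (ii) ⇒ (i) is the real content.  If the end i (resp. k) of a forbidden pattern lies in the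
-- waning block, the other end can be replaced by a translate i + mn (resp. k − mn): the waning
-- block is closed under x ↦ x ± n and these shifts move ≺-downwards as x grows, so for m large
-- the translate is again a valid end of the pattern, now in the block of i (resp. k).
-- Otherwise the shape condition puts k and i into one waxing block, or forces j into a waxing
-- block on the wrong side of L̄_c / R̄_c.  For (iii) ⇒ (ii), walk ≺-upwards from k to i through
-- the finitely many elements between them: some single step drops from above j to at most j.
module Submission where

open import Defs
open import Data.Nat using (ℕ; NonZero; _≤_)
open import Data.Integer using (ℤ)
open import Data.Product using (_×_)
open import Function.Bundles using (_⇔_)

open import Data.Nat as ℕ using (zero; suc; >-nonZero⁻¹)
import Data.Nat.Properties as ℕ
open import Data.Integer as ℤ using (+_; _+_; _-_; ∣_∣; +≤+; +<+)
import Data.Integer.Properties as ℤ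
open import Data.Integer.Tactic.RingSolver using (solve-∀)
open import Data.List using ([]; _∷_; _++_)
open import Data.List.Membership.Propositional using (_∈_)
open import Data.List.Membership.Propositional.Properties using (∈-++⁺ˡ; ∈-++⁺ʳ)
open import Data.List.Relation.Unary.Any using (here; there; tail)
open import Data.List.Relation.Unary.Any.Properties using (¬Any[])
open import Data.Product using (∃; ∃₂; _,_; proj₁; proj₂)
open import Data.Sum using (_⊎_; inj₁; inj₂; [_,_]; [_,_]′; swap)
open import Effect.Monad using (RawMonad)
open import Level using (0ℓ)
open import Function using (_∘_)
open import Function.Bundles using (mk⇔)
open import Relation.Binary.Definitions using (tri<; tri≈; tri>)
open import Relation.Binary.PropositionalEquality using (_≡_; refl; sym; subst; cong; module ≡-Reasoning)
open import Relation.Binary.Structures using (IsStrictTotalOrder)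
open import Relation.Nullary using (¬_; yes; no)
open import Relation.Nullary.Decidable using (_×-dec_; ¬¬-excluded-middle)
open import Relation.Nullary.Negation using (¬¬-Monad; contradiction)
open import Relation.Unary using (Decidable)

private
  x-y+y≡x : ∀ x y → x - y + y ≡ x
  x-y+y≡x = solve-∀

  x+[1+d]≡x+d+1 : ∀ x d → x + (+ 1 + d) ≡ x + d + + 1
  x+[1+d]≡x+d+1 = solve-∀

  x-m+[m+d]≡x+d : ∀ x m d → x - m + (m + d) ≡ x + d
  x-m+[m+d]≡x+d = solve-∀

  i+[j-i]≡j : ∀ i j → i + (j - i) ≡ j
  i+[j-i]≡j = solve-∀

i+∣i-j∣≡j : ∀ {i j} → i ℤ.≤ j → i + + ∣ i - j ∣ ≡ j
i+∣i-j∣≡j {i} {j} i≤j = begin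
  i + + ∣ i - j ∣  ≡⟨ cong (λ d → i + d) (ℤ.∣-∣-≤ i≤j) ⟩
  i + (j - i)      ≡⟨ i+[j-i]≡j i j ⟩
  j                ∎
  where open ≡-Reasoning

+-cancelʳ-< : ∀ {i j} k → i + k ℤ.< j + k → i ℤ.< j
+-cancelʳ-< k i+k<j+k = ℤ.≰⇒> (λ j≤i → ℤ.<⇒≱ i+k<j+k (ℤ.+-monoˡ-≤ k j≤i))

<-shift-up : ∀ x d {u m} → 0 ℕ.< m → x + + d ℤ.< u → x + + suc d ℤ.< u + + m
<-shift-up x d {u} {m} m>0 x+d<u = begin-strict
  x + + suc d    ≡⟨ x+[1+d]≡x+d+1 x (+ d) ⟩
  x + + d + + 1  <⟨ ℤ.+-mono-<-≤ x+d<u (+≤+ m>0) ⟩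
  u + + m        ∎
  where open ℤ.≤-Reasoning

<-shift-down : ∀ u d {x m} → 0 ℕ.< m → u + + d ℤ.< x → u - + m + + suc d ℤ.< x
<-shift-down u d {x} {m} m>0 u+d<x = begin-strict
  u - + m + + suc d        ≤⟨ ℤ.+-monoʳ-≤ (u - + m) (+≤+ (ℕ.+-monoˡ-≤ d m>0)) ⟩
  u - + m + (+ m + + d)    ≡⟨ x-m+[m+d]≡x+d u (+ m) (+ d) ⟩
  u + + d                  <⟨ u+d<x ⟩
  x                        ∎
  where open ℤ.≤-Reasoning

module Blocks {_≺_ : ℤ → ℤ → Set} (sto : IsStrictTotalOrder _≡_ _≺_) where
  open IsStrictTotalOrder sto using (compare; irrefl; asym; trans; _<?_; <-respʳ-≈; <-respˡ-≈)
  open import Relation.Binary.Construct.StrictToNonStrict _≡_ _≺_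
    using (<-≤-trans; ≤-<-trans) renaming (_≤_ to _≼_) public

  private
    Btw = Between _≺_
    Blk = SameBlock _≺_

  between-split : ∀ {x y z} w → Btw x y z → z ≡ w ⊎ Btw x w z ⊎ Btw w y z
  between-split {z = z} w (inj₁ (x≺z , z≺y)) with compare z w
  ... | tri< z≺w _ _ = inj₂ (inj₁ (inj₁ (x≺z , z≺w)))
  ... | tri≈ _ z≡w _ = inj₁ z≡w
  ... | tri> _ _ w≺z = inj₂ (inj₂ (inj₁ (w≺z , z≺y)))
  between-split {z = z} w (inj₂ (y≺z , z≺x)) with compare z w
  ... | tri< z≺w _ _ = inj₂ (inj₂ (inj₂ (y≺z , z≺w)))
  ... | tri≈ _ z≡w _ = inj₁ z≡w
  ... | tri> _ _ w≺z = inj₂ (inj₁ (inj₂ (w≺z , z≺x)))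

  between-narrow : ∀ {x y z t} → Btw x y z → Btw x z t → Btw x y t
  between-narrow (inj₁ (x≺z , z≺y)) (inj₁ (x≺t , t≺z)) = inj₁ (x≺t , trans t≺z z≺y)
  between-narrow (inj₁ (x≺z , _))   (inj₂ (z≺t , t≺x)) = contradiction (trans z≺t t≺x) (asym x≺z)
  between-narrow (inj₂ (_ , z≺x))   (inj₁ (x≺t , t≺z)) = contradiction (trans t≺z z≺x) (asym x≺t)
  between-narrow (inj₂ (y≺z , z≺x)) (inj₂ (z≺t , t≺x)) = inj₂ (trans y≺z z≺t , t≺x)

  sameBlock-refl : ∀ x → Blk x x
  sameBlock-refl x = [] , λ _ → [ impossible , impossible ]
    where
    impossible : ∀ {z} → x ≺ z × z ≺ x → z ∈ []
    impossible (x≺z , z≺x) = contradiction z≺x (asym x≺z)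

  sameBlock-sym : ∀ {x y} → Blk x y → Blk y x
  sameBlock-sym (zs , cover) = zs , λ z → cover z ∘ swap

  sameBlock-trans : ∀ {x w y} → Blk x w → Blk w y → Blk x y
  sameBlock-trans {w = w} (xs , coverˡ) (ys , coverʳ) = w ∷ xs ++ ys , λ z x-z-y →
    [ here , [ there ∘ ∈-++⁺ˡ ∘ coverˡ z , there ∘ ∈-++⁺ʳ xs ∘ coverʳ z ]′ ]′ (between-split w x-z-y)

  sameBlock-convex : ∀ {x y z} → Blk x y → Btw x y z → Blk x z
  sameBlock-convex (zs , cover) x-z-y = zs , λ t → cover t ∘ between-narrow x-z-y

  ¬sameBlock⇒≺⊎≻ : ∀ {w x} → ¬ Blk w x → x ≺ w ⊎ w ≺ x
  ¬sameBlock⇒≺⊎≻ {w} {x} ¬wx with compare x w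
  ... | tri< x≺w _ _ = inj₁ x≺w
  ... | tri≈ _ refl _ = contradiction (sameBlock-refl w) ¬wx
  ... | tri> _ _ w≺x = inj₂ w≺x

  consecutive⇒sameBlock : ∀ {x y} → Consecutive _≺_ x y → Blk x y
  consecutive⇒sameBlock (x≺y , gap) =
    [] , λ z → [ (λ x-z-y → contradiction x-z-y (gap z))
               , (λ (y≺z , z≺x) → contradiction (trans y≺z z≺x) (asym x≺y)) ]

  ≺-≼-trans : ∀ {x y z} → x ≺ y → y ≼ z → x ≺ z
  ≺-≼-trans = <-≤-trans trans <-respʳ-≈

  ≼-≺-trans : ∀ {x y z} → x ≼ y → y ≺ z → x ≺ z
  ≼-≺-trans = ≤-<-trans sym trans <-respˡ-≈

  consecutive-crossing : ∀ {P : ℤ → Set} → Decidable P → ∀ zs {a b} → a ≺ b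
    → (∀ z → a ≺ z → z ≺ b → z ∈ zs) → P a → ¬ P b
    → ∃₂ λ x y → Consecutive _≺_ x y × P x × ¬ P y × a ≼ x × y ≼ b
  consecutive-crossing P? [] a≺b cover pa ¬pb =
    _ , _ , (a≺b , λ z (a≺z , z≺b) → ¬Any[] (cover z a≺z z≺b)) , pa , ¬pb , inj₂ refl , inj₂ refl
  consecutive-crossing P? (z ∷ zs) {a} {b} a≺b cover pa ¬pb with a <? z ×-dec z <? b
  ... | no z∉⟨a,b⟩ = consecutive-crossing P? zs a≺b
          (λ t a≺t t≺b → tail (λ { refl → z∉⟨a,b⟩ (a≺t , t≺b) }) (cover t a≺t t≺b)) pa ¬pb
  ... | yes (a≺z , z≺b) with P? z
  ...   | yes pz =
          let x , y , x⋖y , px , ¬py , z≼x , y≼b = consecutive-crossing P? zs z≺b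
                (λ t z≺t t≺b → tail (λ { refl → irrefl refl z≺t }) (cover t (trans a≺z z≺t) t≺b)) pz ¬pb
          in x , y , x⋖y , px , ¬py , inj₁ (≺-≼-trans a≺z z≼x) , y≼b
  ...   | no ¬pz =
          let x , y , x⋖y , px , ¬py , a≼x , y≼z = consecutive-crossing P? zs a≺z
                (λ t a≺t t≺z → tail (λ { refl → irrefl refl t≺z }) (cover t a≺t (trans t≺z z≺b))) pa ¬pz
          in x , y , x⋖y , px , ¬py , a≼x , inj₁ (≼-≺-trans y≼z z≺b)

module WaningBlock (n : ℕ) .{{_ : NonZero n}} {_≺_ : ℤ → ℤ → Set} (tito : IsTITO n _≺_) (w : ℤ)
  (waning  : ∀ x → SameBlock _≺_ w x → (x + + n) ≺ x)
  (waxing  : ∀ x → ¬ SameBlock _≺_ w x → x ≺ (x + + n)) where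

  open IsTITO tito
  open IsStrictTotalOrder strictTotal using (asym; trans)
  -- Block membership is undecidable, so these arguments run in the double-negation monad;
  -- that suffices because every conclusion drawn from them is a negation.
  open RawMonad (¬¬-Monad {0ℓ})

  private
    B = SameBlock _≺_ w

  +n-closed : ∀ {x} → B x → ¬ ¬ B (x + + n)
  +n-closed {x} bx ¬b = asym (waxing (x + + n) ¬b) (proj₁ (translate (x + + n) x) (waning x bx))

  ≺-n : ∀ {x} → B x → x ≺ (x - + n)
  ≺-n {x} bx = proj₂ (translate x (x - + n)) (subst ((x + + n) ≺_) (sym (x-y+y≡x x (+ n))) (waning x bx))

  -n-closed : ∀ {x} → B x → ¬ ¬ B (x - + n)
  -n-closed {x} bx ¬b = asym (≺-n bx) (subst ((x - + n) ≺_) (x-y+y≡x x (+ n)) (waxing (x - + n) ¬b))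

  escape-above : ∀ {x} t → x ℤ.≤ t → B x → ¬ ¬ (∃ λ u → B u × u ≺ x × t ℤ.< u)
  escape-above {x} t x≤t bx = subst-bound <$> go ∣ x - t ∣
    where
    subst-bound : (∃ λ u → B u × u ≺ x × x + + ∣ x - t ∣ ℤ.< u) → ∃ λ u → B u × u ≺ x × t ℤ.< u
    subst-bound (u , bu , u≺x , bound) = u , bu , u≺x , subst (ℤ._< u) (i+∣i-j∣≡j x≤t) bound
    go : ∀ d → ¬ ¬ (∃ λ u → B u × u ≺ x × x + + d ℤ.< u)
    go zero = do
      b ← +n-closed bx
      pure (x + + n , b , waning x bx , ℤ.+-monoʳ-< x (+<+ (>-nonZero⁻¹ n)))
    go (suc d) = do
      u , bu , u≺x , x+d<u ← go d
      b ← +n-closed bu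
      pure (u + + n , b , trans (waning u bu) u≺x , <-shift-up x d (>-nonZero⁻¹ n) x+d<u)

  escape-below : ∀ {x} t → t ℤ.≤ x → B x → ¬ ¬ (∃ λ u → B u × x ≺ u × u ℤ.< t)
  escape-below {x} t t≤x bx = subst-bound <$> go ∣ t - x ∣
    where
    subst-bound : (∃ λ u → B u × x ≺ u × u + + ∣ t - x ∣ ℤ.< x) → ∃ λ u → B u × x ≺ u × u ℤ.< t
    subst-bound (u , bu , x≺u , bound) =
      u , bu , x≺u , +-cancelʳ-< (+ ∣ t - x ∣) (subst (u + + ∣ t - x ∣ ℤ.<_) (sym (i+∣i-j∣≡j t≤x)) bound)
    go : ∀ d → ¬ ¬ (∃ λ u → B u × x ≺ u × u + + d ℤ.< x)
    go zero = do
      b ← -n-closed bx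
      pure (x - + n , b , ≺-n bx ,
            subst ((x - + n) + + 0 ℤ.<_) (x-y+y≡x x (+ n)) (ℤ.+-monoʳ-< (x - + n) (+<+ (>-nonZero⁻¹ n))))
    go (suc d) = do
      u , bu , x≺u , u+d<x ← go d
      b ← -n-closed bu
      pure (u - + n , b , trans x≺u (≺-n bu) , <-shift-down u d (>-nonZero⁻¹ n) u+d<x)

module _ (n : ℕ) .{{_ : NonZero n}} (c : CoxeterWord n) {_≺_ : ℤ → ℤ → Set} where

  private
    L = Lc n c
    R = Rc n c

  ¬L∧R : ∀ {x} → L x → ¬ R x
  ¬L∧R = ℤ.<-asym

  sortable⇒patternBlock : Sortable n c _≺_ → PatternBlock n c _≺_
  sortable⇒patternBlock (_ , avoidᴸ , avoidᴿ) =
      (λ i j k i<j j<k (k≺i , i≺j , Lj , _) → avoidᴸ i j k i<j j<k (k≺i , i≺j , Lj))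
    , (λ i j k i<j j<k (j≺k , k≺i , Rj , _) → avoidᴿ i j k i<j j<k (j≺k , k≺i , Rj))

  module _ (sto : IsStrictTotalOrder _≡_ _≺_) where
    open IsStrictTotalOrder sto using (irrefl; asym)
    open Blocks sto

    patternBlock⇒patternConsec : PatternBlock n c _≺_ → PatternConsec n c _≺_
    patternBlock⇒patternConsec (avoidᴸ , avoidᴿ) =
        (λ i j k i<j j<k (k⋖i , i≺j , Lj) →
           avoidᴸ i j k i<j j<k (proj₁ k⋖i , i≺j , Lj , consecutive⇒sameBlock k⋖i))
      , (λ i j k i<j j<k (j≺k , k⋖i , Rj) →
           avoidᴿ i j k i<j j<k (j≺k , proj₁ k⋖i , Rj , consecutive⇒sameBlock k⋖i))

    step-over : ∀ {i j k} → i ℤ.< j → j ℤ.< k → k ≺ i → SameBlock _≺_ k i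
      → ∃₂ λ x y → Consecutive _≺_ x y × y ℤ.≤ j × j ℤ.< x × k ≼ x × y ≼ i
    step-over {j = j} i<j j<k k≺i (zs , cover) =
      let x , y , x⋖y , j<x , j≮y , k≼x , y≼i = consecutive-crossing (j ℤ.<?_) zs k≺i
            (λ z k≺z z≺i → cover z (inj₁ (k≺z , z≺i))) j<k (ℤ.<-asym i<j)
      in x , y , x⋖y , ℤ.≮⇒≥ j≮y , j<x , k≼x , y≼i

    patternConsec⇒patternBlock : PatternConsec n c _≺_ → PatternBlock n c _≺_
    patternConsec⇒patternBlock (avoidᴸ , avoidᴿ) = avoidᴸ′ , avoidᴿ′
      where
      avoidᴸ′ : ∀ i j k → i ℤ.< j → j ℤ.< k → ¬ (k ≺ i × i ≺ j × L j × SameBlock _≺_ k i)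
      avoidᴸ′ i j k i<j j<k (k≺i , i≺j , Lj , k~i) =
        let x , y , x⋖y , y≤j , j<x , _ , y≼i = step-over i<j j<k k≺i k~i
            y≺j = ≼-≺-trans y≼i i≺j
            y<j = ℤ.≤∧≢⇒< y≤j (λ y≡j → irrefl y≡j y≺j)
        in avoidᴸ y j x y<j j<x (x⋖y , y≺j , Lj)
      avoidᴿ′ : ∀ i j k → i ℤ.< j → j ℤ.< k → ¬ (j ≺ k × k ≺ i × R j × SameBlock _≺_ k i)
      avoidᴿ′ i j k i<j j<k (j≺k , k≺i , Rj , k~i) =
        let x , y , x⋖y , y≤j , j<x , k≼x , _ = step-over i<j j<k k≺i k~i
            j≺x = ≺-≼-trans j≺k k≼x
            y<j = ℤ.≤∧≢⇒< y≤j (λ y≡j → asym j≺x (subst (x ≺_) y≡j (proj₁ x⋖y)))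
        in avoidᴿ y j x y<j j<x (j≺x , x⋖y , Rj)

  module _ (tito : IsTITO n _≺_) where
    open IsTITO tito using (strictTotal)
    open IsStrictTotalOrder strictTotal using (trans)
    open Blocks strictTotal

    patternBlock⇒pattern : Shape n c _≺_ → PatternBlock n c _≺_ → Pattern n c _≺_
    patternBlock⇒pattern (inj₁ (oneBlock , _)) (avoidᴸ , avoidᴿ) =
        (λ i j k i<j j<k (k≺i , i≺j , Lj) → avoidᴸ i j k i<j j<k (k≺i , i≺j , Lj , oneBlock k i))
      , (λ i j k i<j j<k (j≺k , k≺i , Rj) → avoidᴿ i j k i<j j<k (j≺k , k≺i , Rj , oneBlock k i))
    patternBlock⇒pattern (inj₂ (w , waning , _ , _ , before , after , waxing-before , waxing-after))
                         (avoidᴸ , avoidᴿ) = avoidᴸ′ , avoidᴿ′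
      where
      B = SameBlock _≺_ w

      waxing : ∀ x → ¬ B x → x ≺ (x + + n)
      waxing x ¬bx = [ proj₁ ∘ waxing-before x ¬bx , proj₁ ∘ waxing-after x ¬bx ]′ (¬sameBlock⇒≺⊎≻ ¬bx)

      open WaningBlock n tito w waning waxing

      avoidᴸ′ : ∀ i j k → i ℤ.< j → j ℤ.< k → ¬ (k ≺ i × i ≺ j × L j)
      avoidᴸ′ i j k i<j j<k (k≺i , i≺j , Lj) = ¬¬-excluded-middle λ where
        (yes bi) → escape-above j (ℤ.<⇒≤ i<j) bi λ (u , bu , u≺i , j<u) →
          avoidᴸ i j u i<j j<u (u≺i , i≺j , Lj , sameBlock-trans (sameBlock-sym bu) bi)
        (no ¬bi) → [ (λ i≺w →
                       let ¬bk = ¬bi ∘ λ bk → sameBlock-convex bk (inj₂ (k≺i , i≺w))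
                       in avoidᴸ i j k i<j j<k (k≺i , i≺j , Lj , before k i ¬bk ¬bi (trans k≺i i≺w) i≺w))
                   , (λ w≺i →
                       let ¬bj = ¬bi ∘ λ bj → sameBlock-convex bj (inj₁ (w≺i , i≺j))
                       in ¬L∧R Lj (proj₂ (waxing-after j ¬bj (trans w≺i i≺j))))
                   ]′ (¬sameBlock⇒≺⊎≻ ¬bi)

      avoidᴿ′ : ∀ i j k → i ℤ.< j → j ℤ.< k → ¬ (j ≺ k × k ≺ i × R j)
      avoidᴿ′ i j k i<j j<k (j≺k , k≺i , Rj) = ¬¬-excluded-middle λ where
        (yes bk) → escape-below j (ℤ.<⇒≤ j<k) bk λ (u , bu , k≺u , u<j) →
          avoidᴿ u j k u<j j<k (j≺k , k≺u , Rj , sameBlock-trans (sameBlock-sym bk) bu)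
        (no ¬bk) → [ (λ k≺w →
                       let ¬bj = ¬bk ∘ λ bj → sameBlock-convex bj (inj₂ (j≺k , k≺w))
                       in ¬L∧R (proj₂ (waxing-before j ¬bj (trans j≺k k≺w))) Rj)
                   , (λ w≺k →
                       let ¬bi = ¬bk ∘ λ bi → sameBlock-convex bi (inj₁ (w≺k , k≺i))
                       in avoidᴿ i j k i<j j<k (j≺k , k≺i , Rj , after k i ¬bk ¬bi w≺k (trans w≺k k≺i)))
                   ]′ (¬sameBlock⇒≺⊎≻ ¬bk)

proposition3p6 : (n : ℕ) .{{_ : NonZero n}} → 2 ≤ n → (c : CoxeterWord n)
    → (_≺_ : ℤ → ℤ → Set) → IsTITO n _≺_ → Shape n c _≺_
    → (Sortable n c _≺_ ⇔ PatternBlock n c _≺_)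
      × (PatternBlock n c _≺_ ⇔ PatternConsec n c _≺_)
proposition3p6 n _ c _≺_ tito shape =
    mk⇔ (sortable⇒patternBlock n c) (λ pb → shape , patternBlock⇒pattern n c tito shape pb)
  , mk⇔ (patternBlock⇒patternConsec n c sto) (patternConsec⇒patternBlock n c sto)
  where
  sto = IsTITO.strictTotal tito
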